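{- Let $c$ be a positive integer, let $k_1,\dots,k_c$ and $r_1,\dots,r_c$ be positive integers, and set $k = \sum_{i=1}^c k_i$ and $r = \sum_{i=1}^c r_i$. Then for any graph $G$, \[\sigma(G,r,k-c+1) \leq \sum_{i=1}^c \sigma(G,r_i,k_i).\]
   Context: Graphs are simple and undirected and may be infinite. For a graph $G$ and positive integers $r,s,k$, the game "Revolutionaries and Spies" $\mathcal{G}(G,r,s,k)$ is played between a team of $r$ revolutionaries and a team of $s$ spies with perfect information. In round $0$, each revolutionary chooses a vertex of $G$ as its position, and then each spy does the same; any number of agents may occupy the same vertex at any time. In each round $i \ge 1$, first every revolutionary simultaneously either stays at its vertex or moves to an adjacent vertex, and then every spy does the same. A meeting of size $k$ at a vertex $v$ means at least $k$ revolutionaries are at $v$; it is guarded if at least one spy is at $v$. The revolutionaries win if at the end of some round (after the spies have moved in that round) there is an unguarded meeting of size $k$; otherwise the spies win. $\sigma(G,r,k)$ denotes the minimum positive integer $s$ such that the spies have a winning strategy in $\mathcal{G}(G,r,s,k)$. -}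

module Defs where

open import Data.Nat using (ℕ; zero; suc; _+_; _∸_; _≤_; _<_)
open import Data.Fin using (Fin; toℕ)
open import Data.Product using (Σ; _×_; ∃; _,_)
import Data.Product
open import Data.Sum using (_⊎_)
open import Data.Empty using (⊥)
open import Relation.Nullary using (¬_)
open import Relation.Binary.PropositionalEquality using (_≡_; _≢_)
open import Function.Definitions using (Injective)
import Data.Vec.Functional as VF

record Graph : Set₁ where
  field
    V       : Set
    Adj     : V → V → Set
    Adj-sym : ∀ {x y} → Adj x y → Adj y x
    irrefl  : ∀ {x} → ¬ Adj x x
open Graph public

Step : (G : Graph) → V G → V G → Set
Step G x y = x ≡ y ⊎ Adj G x y

Config : Graph → ℕ → Set
Config G n = Fin n → V G

ConfigStep : (G : Graph) {n : ℕ} → Config G n → Config G n → Set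
ConfigStep G {n} X Y = (j : Fin n) → Step G (X j) (Y j)

Meeting : (G : Graph) {r : ℕ} (k : ℕ) → Config G r → V G → Set
Meeting G {r} k R v =
  Σ (Fin k → Fin r) λ f → Injective _≡_ _≡_ f × ((i : Fin k) → R (f i) ≡ v)

Guarded : (G : Graph) {s : ℕ} → Config G s → V G → Set
Guarded G {s} S v = ∃ λ (j : Fin s) → S j ≡ v

UnguardedMeeting : (G : Graph) {r s : ℕ} (k : ℕ) → Config G r → Config G s → Set
UnguardedMeeting G k R S = ∃ λ (v : V G) → Meeting G k R v × ¬ Guarded G S v

-- A (deterministic) spy strategy: in round i, given the revolutionaries'
-- positions in rounds 0..i (perfect information; spies' own earlier
-- positions are determined by the strategy), choose the spies' positions.
SpyStrategy : Graph → ℕ → ℕ → Set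
SpyStrategy G r s = (i : ℕ) → (Fin (suc i) → Config G r) → Config G s

RevPlay : Graph → ℕ → Set
RevPlay G r = Σ (ℕ → Config G r) λ R → (i : ℕ) → ConfigStep G (R i) (R (suc i))

spyPos : {G : Graph} {r s : ℕ} → SpyStrategy G r s → (ℕ → Config G r) → ℕ → Config G s
spyPos str R i = str i (λ j → R (toℕ j))

Winning : (G : Graph) (r s k : ℕ) → SpyStrategy G r s → Set
Winning G r s k str = (P : RevPlay G r) → let R = Data.Product.proj₁ P in
  ((i : ℕ) → ConfigStep G (spyPos {G} {r} {s} str R i) (spyPos {G} {r} {s} str R (suc i)))
  × ((i : ℕ) → ¬ UnguardedMeeting G k (R i) (spyPos {G} {r} {s} str R i))

SpiesWin : (G : Graph) (r s k : ℕ) → Set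
SpiesWin G r s k = Σ (SpyStrategy G r s) (Winning G r s k)

-- s = σ(G, r, k): the least positive s for which the spies win.
IsSigma : (G : Graph) (r k s : ℕ) → Set
IsSigma G r k s =
  1 ≤ s × SpiesWin G r s k × ((t : ℕ) → 1 ≤ t → t < s → ¬ SpiesWin G r t k)

∑ : {c : ℕ} → (Fin c → ℕ) → ℕ
∑ f = VF.foldr _+_ 0 f

{-# OPTIONS --safe #-}
-- Split the revolutionaries into c teams of sizes r₁, …, r_c and let the i-th
-- team of spies play a winning strategy of 𝒢(G, rᵢ, sᵢ, kᵢ) against the i-th
-- team alone. A meeting of size k − c + 1 contains, by pigeonhole, at least kᵢ
-- members of some team i, so it is guarded by the i-th team of spies.
module Submission where

open import Defs
open import Data.Nat using (ℕ; zero; suc; _+_; _∸_; _≤_; z≤n)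
open import Data.Nat.Properties
  using (≤-pred; ≤-trans; ≤-reflexive; +-mono-≤; m+n≤o⇒n≤o; +-suc; +-comm; +-assoc;
         +-identityʳ; +-cancelʳ-≡; m≤n⇒∃[o]m+o≡n; m∸n+n≡m; ≮⇒≥)
open import Data.Nat.Tactic.RingSolver using (solve-∀)
open import Data.Fin using (Fin; zero; suc; _↑ˡ_; _↑ʳ_; splitAt)
open import Data.Fin.Properties using (¬Fin0; suc-injective; splitAt⁻¹-↑ˡ; splitAt⁻¹-↑ʳ)
open import Data.Product using (Σ; _×_; _,_; proj₁; proj₂)
open import Data.Sum using (_⊎_; inj₁; inj₂)
open import Data.Empty using (⊥-elim)
open import Function using (_∘_)
open import Function.Definitions using (Injective)
open import Relation.Binary.PropositionalEquality
open import Data.Vec.Functional using (_++_)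
open import Data.Vec.Functional.Properties using (lookup-++ˡ; lookup-++ʳ)
open import Relation.Nullary using (¬_)

record AtLeast {n} (k : ℕ) (P : Fin n → Set) : Set where
  constructor atLeast
  field
    elems     : Fin k → Fin n
    injective : Injective _≡_ _≡_ elems
    satisfies : ∀ i → P (elems i)

module _ {n : ℕ} {P : Fin n → Set} where

  atLeast-zero : AtLeast 0 P
  atLeast-zero = atLeast (λ ()) (λ {i} → λ { }) (λ ())

  atLeast-cons : ∀ {k a} → P a → AtLeast k (λ j → P j × j ≢ a) → AtLeast (suc k) P
  atLeast-cons {a = a} Pa (atLeast f f-inj Pf) = atLeast g g-inj Pg
    where
      g : Fin (suc _) → Fin n
      g zero    = a
      g (suc i) = f i
      g-inj : Injective _≡_ _≡_ g
      g-inj {zero}  {zero}  _  = refl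
      g-inj {zero}  {suc j} eq = ⊥-elim (proj₂ (Pf j) (sym eq))
      g-inj {suc i} {zero}  eq = ⊥-elim (proj₂ (Pf i) eq)
      g-inj {suc i} {suc j} eq = cong suc (f-inj eq)
      Pg : ∀ i → P (g i)
      Pg zero    = Pa
      Pg (suc i) = proj₁ (Pf i)

  atLeast-uncons : ∀ {k} → AtLeast (suc k) P → Σ (Fin n) λ a → P a × AtLeast k (λ j → P j × j ≢ a)
  atLeast-uncons (atLeast f f-inj Pf) =
    f zero , Pf zero , atLeast (f ∘ suc) (suc-injective ∘ f-inj) (λ i → Pf (suc i) , (λ ()) ∘ f-inj)

atLeast-map : ∀ {n k} {P Q : Fin n → Set} → (∀ {j} → P j → Q j) → AtLeast k P → AtLeast k Q
atLeast-map P⇒Q (atLeast f f-inj Pf) = atLeast f f-inj (P⇒Q ∘ Pf)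

data SplitAt (m n : ℕ) : Fin (m + n) → Set where
  left  : ∀ i → SplitAt m n (i ↑ˡ n)
  right : ∀ j → SplitAt m n (m ↑ʳ j)

splitAt-view : ∀ m n i → SplitAt m n i
splitAt-view m n i with splitAt m i in eq
... | inj₁ x = subst (SplitAt m n) (splitAt⁻¹-↑ˡ eq) (left x)
... | inj₂ y = subst (SplitAt m n) (splitAt⁻¹-↑ʳ eq) (right y)

atLeast-++ : ∀ m n {P : Fin (m + n) → Set} {k} k₁ k₂ → k₁ + k₂ ≤ suc k → AtLeast k P →
             AtLeast k₁ (P ∘ (_↑ˡ n)) ⊎ AtLeast k₂ (P ∘ (m ↑ʳ_))
atLeast-++ m n zero     k₂       _ _ = inj₁ atLeast-zero
atLeast-++ m n (suc k₁) zero     _ _ = inj₂ atLeast-zero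
atLeast-++ m n {k = zero} (suc k₁) (suc k₂) le _ with () ← m+n≤o⇒n≤o k₁ (≤-pred le)
atLeast-++ m n {k = suc k} (suc k₁) (suc k₂) le A with atLeast-uncons A
... | a , Pa , rest with splitAt-view m n a
...   | left x with atLeast-++ m n k₁ (suc k₂) (≤-pred le) rest
...     | inj₁ A₁ = inj₁ (atLeast-cons Pa (atLeast-map (λ (p , ne) → p , ne ∘ cong (_↑ˡ n)) A₁))
...     | inj₂ A₂ = inj₂ (atLeast-map proj₁ A₂)
atLeast-++ m n {k = suc k} (suc k₁) (suc k₂) le A
  | a , Pa , rest | right y with atLeast-++ m n (suc k₁) k₂ (subst (_≤ suc k) (+-suc k₁ k₂) (≤-pred le)) rest
...     | inj₁ A₁ = inj₁ (atLeast-map proj₁ A₁)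
...     | inj₂ A₂ = inj₂ (atLeast-cons Pa (atLeast-map (λ (p , ne) → p , ne ∘ cong (m ↑ʳ_)) A₂))

length≤∑ : ∀ {c} (f : Fin c → ℕ) → (∀ i → 1 ≤ f i) → c ≤ ∑ f
length≤∑ {zero}  f pos = z≤n
length≤∑ {suc c} f pos = +-mono-≤ (pos zero) (length≤∑ (f ∘ suc) (pos ∘ suc))

module _ {G : Graph} where

  meeting⇒atLeast : ∀ {r k} {R : Config G r} {v} → Meeting G k R v → AtLeast k (λ j → R j ≡ v)
  meeting⇒atLeast (f , f-inj , at) = atLeast f f-inj at

  atLeast⇒meeting : ∀ {r k} {R : Config G r} {v} → AtLeast k (λ j → R j ≡ v) → Meeting G k R v
  atLeast⇒meeting (atLeast f f-inj at) = f , f-inj , at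

  configStep-++ : ∀ {m n} {A A' : Config G m} {B B' : Config G n} →
    ConfigStep G A A' → ConfigStep G B B' → ConfigStep G (A ++ B) (A' ++ B')
  configStep-++ {m} A→A' B→B' j with splitAt m j
  ... | inj₁ x = A→A' x
  ... | inj₂ y = B→B' y

  guarded-++ˡ : ∀ {s₁ s₂} {S₁ : Config G s₁} {S₂ : Config G s₂} {v} →
    Guarded G S₁ v → Guarded G (S₁ ++ S₂) v
  guarded-++ˡ {S₁ = S₁} {S₂} (j , eq) = j ↑ˡ _ , trans (lookup-++ˡ S₁ S₂ j) eq

  guarded-++ʳ : ∀ {s₁ s₂} {S₁ : Config G s₁} {S₂ : Config G s₂} {v} →
    Guarded G S₂ v → Guarded G (S₁ ++ S₂) v
  guarded-++ʳ {S₁ = S₁} {S₂} (j , eq) = _ ↑ʳ j , trans (lookup-++ʳ S₁ S₂ j) eq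

  unguardedMeeting-++ : ∀ {r₁ r₂ s₁ s₂ k} k₁ k₂ → k₁ + k₂ ≤ suc k →
    {R : Config G (r₁ + r₂)} {S₁ : Config G s₁} {S₂ : Config G s₂} →
    UnguardedMeeting G k R (S₁ ++ S₂) →
    UnguardedMeeting G k₁ (R ∘ (_↑ˡ r₂)) S₁ ⊎ UnguardedMeeting G k₂ (R ∘ (r₁ ↑ʳ_)) S₂
  unguardedMeeting-++ {r₁} {r₂} k₁ k₂ le {R} (v , meeting , unguarded)
    with atLeast-++ r₁ r₂ k₁ k₂ le (meeting⇒atLeast {R = R} meeting)
  ... | inj₁ meeting₁ = inj₁ (v , atLeast⇒meeting meeting₁ , unguarded ∘ guarded-++ˡ)
  ... | inj₂ meeting₂ = inj₂ (v , atLeast⇒meeting meeting₂ , unguarded ∘ guarded-++ʳ)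

  spiesWin-+ : ∀ {r₁ r₂ s₁ s₂ k₁ k₂ k} → k₁ + k₂ ≤ suc k →
    SpiesWin G r₁ s₁ k₁ → SpiesWin G r₂ s₂ k₂ → SpiesWin G (r₁ + r₂) (s₁ + s₂) k
  spiesWin-+ {r₁} {r₂} {s₁} {s₂} {k₁} {k₂} {k} le (σ₁ , win₁) (σ₂ , win₂) = σ , win
    where
      σ : SpyStrategy G (r₁ + r₂) (s₁ + s₂)
      σ i H = σ₁ i (λ t → H t ∘ (_↑ˡ r₂)) ++ σ₂ i (λ t → H t ∘ (r₁ ↑ʳ_))
      win : Winning G (r₁ + r₂) (s₁ + s₂) k σ
      win (R , legal) = (λ i → configStep-++ (moves₁ i) (moves₂ i)) , safe
        where
          play₁ = win₁ ((λ i → R i ∘ (_↑ˡ r₂)) , λ i → legal i ∘ (_↑ˡ r₂))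
          play₂ = win₂ ((λ i → R i ∘ (r₁ ↑ʳ_)) , λ i → legal i ∘ (r₁ ↑ʳ_))
          moves₁ = proj₁ play₁
          moves₂ = proj₁ play₂
          safe : ∀ i → ¬ UnguardedMeeting G k (R i) (spyPos {G} {r₁ + r₂} {s₁ + s₂} σ R i)
          safe i meeting with unguardedMeeting-++ k₁ k₂ le {R = R i} meeting
          ... | inj₁ meeting₁ = proj₂ play₁ i meeting₁
          ... | inj₂ meeting₂ = proj₂ play₂ i meeting₂

  spiesWin-0 : ∀ {k} → SpiesWin G 0 0 (suc k)
  spiesWin-0 = (λ _ _ ()) , λ _ → (λ _ ()) , λ { _ (_ , (f , _) , _) → ¬Fin0 (f zero) }

  spiesWin-∑ : ∀ c (ks rs ss : Fin c → ℕ) → (∀ i → 1 ≤ ks i) →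
    (∀ i → SpiesWin G (rs i) (ss i) (ks i)) →
    ∀ k → k + c ≡ suc (∑ ks) → SpiesWin G (∑ rs) (∑ ss) k
  spiesWin-∑ zero ks rs ss _ _ k eq with refl ← trans (sym (+-identityʳ k)) eq = spiesWin-0
  spiesWin-∑ (suc c) ks rs ss pos win k eq =
    spiesWin-+ (≤-reflexive sizes) (win zero)
      (spiesWin-∑ c (ks ∘ suc) (rs ∘ suc) (ss ∘ suc) (pos ∘ suc) (win ∘ suc) (suc d) rest-size)
    where
      k₀ = ks zero
      S = ∑ (ks ∘ suc)
      excess = m≤n⇒∃[o]m+o≡n (length≤∑ (ks ∘ suc) (pos ∘ suc))
      d = proj₁ excess
      rest-size : suc d + c ≡ suc S
      rest-size = cong suc (trans (+-comm d c) (proj₂ excess))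
      rearrange : ∀ k₀ c d → k₀ + suc d + c ≡ suc (k₀ + (c + d))
      rearrange = solve-∀
      sizes : k₀ + suc d ≡ suc k
      sizes = +-cancelʳ-≡ c (k₀ + suc d) (suc k) (begin
        k₀ + suc d + c      ≡⟨ rearrange k₀ c d ⟩
        suc (k₀ + (c + d))  ≡⟨ cong (λ x → suc (k₀ + x)) (proj₂ excess) ⟩
        suc (k₀ + S)        ≡⟨ sym eq ⟩
        k + suc c           ≡⟨ +-suc k c ⟩
        suc k + c           ∎)
        where open ≡-Reasoning

mainTheorem3 : (G : Graph) (c : ℕ) → 1 ≤ c →
    (ks rs ss : Fin c → ℕ) →
    ((i : Fin c) → 1 ≤ ks i) → ((i : Fin c) → 1 ≤ rs i) →
    ((i : Fin c) → IsSigma G (rs i) (ks i) (ss i)) →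
    (s : ℕ) → IsSigma G (∑ rs) (∑ ks ∸ c + 1) s →
    s ≤ ∑ ss
mainTheorem3 G c 1≤c ks rs ss 1≤ks _ σs s (_ , _ , minimal) =
  ≮⇒≥ λ ∑ss<s → minimal (∑ ss) 1≤∑ss ∑ss<s combined
  where
    1≤∑ss : 1 ≤ ∑ ss
    1≤∑ss = ≤-trans 1≤c (length≤∑ ss (proj₁ ∘ σs))
    size : ∑ ks ∸ c + 1 + c ≡ suc (∑ ks)
    size = begin
      ∑ ks ∸ c + 1 + c    ≡⟨ +-assoc (∑ ks ∸ c) 1 c ⟩
      ∑ ks ∸ c + suc c    ≡⟨ +-suc (∑ ks ∸ c) c ⟩
      suc (∑ ks ∸ c + c)  ≡⟨ cong suc (m∸n+n≡m (length≤∑ ks 1≤ks)) ⟩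
      suc (∑ ks)          ∎
      where open ≡-Reasoning
    combined : SpiesWin G (∑ rs) (∑ ss) (∑ ks ∸ c + 1)
    combined = spiesWin-∑ {G} c ks rs ss 1≤ks (proj₁ ∘ proj₂ ∘ σs) (∑ ks ∸ c + 1) size
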